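{- Let $M_n=\sum_{k\ge 0}\binom{n}{2k}\frac{1}{k+1}\binom{2k}{k}$ be the Motzkin numbers. For $n\in\mathbb{N}$, $$M_n\equiv\begin{cases}-1\pmod 3&\text{if } n\in 3T(01)-1,\\ 1\pmod 3&\text{if } n\in 3T(01) \text{ or } n\in 3T(01)-2,\\ 0\pmod 3&\text{otherwise.}\end{cases}$$
   Context: $T(01)$ denotes the set of $m\in\mathbb{N}$ whose base-$3$ expansion contains only the digits $0$ and $1$. For a set $X$ of integers and integers $k,l$, $kX+l=\{kx+l : x\in X\}$. -}

module Defs where

open import Data.Nat using (ℕ; zero; suc; _+_; _*_; _/_)
open import Data.Nat.Combinatorics using (_C_)
open import Data.List using (map; upTo)
open import Data.Nat.ListAction using (sum)

-- Catalan number C_k = (1/(k+1)) * binom(2k, k)   (the division is exact)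
catalan : ℕ → ℕ
catalan k = ((2 * k) C k) / suc k

-- Motzkin number M_n = Σ_{k ≥ 0} binom(n, 2k) * (1/(k+1)) binom(2k,k).
-- Terms with 2k > n vanish, so summing over k = 0 .. n suffices.
motzkin : ℕ → ℕ
motzkin n = sum (map (λ k → (n C (2 * k)) * catalan k) (upTo (suc n)))

-- T(01): naturals whose base-3 expansion uses only the digits 0 and 1,
-- defined inductively by appending a least-significant base-3 digit.
data T01 : ℕ → Set where
  t-zero : T01 0
  t-dig0 : ∀ {m} → T01 m → T01 (3 * m)
  t-dig1 : ∀ {m} → T01 m → T01 (3 * m + 1)

-- Since C_k = C(2k,k) - C(2k,k+1), the Motzkin number M_n equals T(n,0) - T(n,2), where
-- T(n,j) is the coefficient of x^j in (1 + x + x⁻¹)^n. By the Frobenius identity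
-- (1 + x + x⁻¹)^3 ≡ 1 + x³ + x⁻³ (mod 3), the rows 3q, 3q + 1 and 3q + 2 of the trinomial
-- triangle mod 3 are determined by row q; in particular T(3q,0) ≡ T(3q+1,0) ≡ T(q,0) and
-- T(3q+2,0) ≡ 0, so T(m,0) ≡ 1 or 0 according as m ∈ T(01) or not. Reading off
-- T(n,0) - T(n,2) on the three residue classes of n gives the corollary.
module Submission where

open import Data.Empty using (⊥-elim)
open import Data.Fin using (Fin; toℕ)
open import Data.Fin.Patterns using (0F; 1F; 2F)
open import Data.Fin.Properties using (_≟_; all?; toℕ-fromℕ<; fromℕ<-cong)
open import Data.List using (map; applyUpTo)
open import Data.Nat using (ℕ; zero; suc; _+_; _*_; _∸_; _/_; _%_; _<_; _≤_; s≤s; z≤n)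
open import Data.Nat.Combinatorics
  using (_C_; nCk+nC[k+1]≡[n+1]C[k+1]; k>n⇒nCk≡0; nC1≡n; nCk≡nC[n∸k])
open import Data.Nat.DivMod using (_mod_; %-distribˡ-+; %-distribˡ-*; m*n/n≡m)
open import Data.Nat.Induction using (<-rec)
open import Data.Nat.ListAction using (sum)
open import Data.Nat.Properties hiding (_≟_)
open import Data.Nat.Tactic.RingSolver using (solve-∀)
open import Data.Product using (∃; _×_; _,_)
open import Data.Sum using (_⊎_; inj₁; inj₂; [_,_]′)
import Data.Sum as Sum
open import Relation.Binary.PropositionalEquality
  using (_≡_; refl; sym; trans; cong; cong₂; subst; module ≡-Reasoning)
open import Relation.Nullary using (¬_)
open import Relation.Nullary.Decidable using (True; toWitness)
open import Defs

open ≡-Reasoning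

∑< : ℕ → (ℕ → ℕ) → ℕ
∑< zero    f = 0
∑< (suc N) f = f 0 + ∑< N (λ k → f (suc k))

∑<-cong : ∀ N {f g : ℕ → ℕ} → (∀ k → f k ≡ g k) → ∑< N f ≡ ∑< N g
∑<-cong zero    f≗g = refl
∑<-cong (suc N) f≗g = cong₂ _+_ (f≗g 0) (∑<-cong N (λ k → f≗g (suc k)))

∑<-distrib-+ : ∀ N (f g : ℕ → ℕ) → ∑< N (λ k → f k + g k) ≡ ∑< N f + ∑< N g
∑<-distrib-+ zero    f g = refl
∑<-distrib-+ (suc N) f g = begin
  f 0 + g 0 + ∑< N (λ k → f (suc k) + g (suc k))
    ≡⟨ cong (f 0 + g 0 +_) (∑<-distrib-+ N (λ k → f (suc k)) (λ k → g (suc k))) ⟩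
  f 0 + g 0 + (∑< N (λ k → f (suc k)) + ∑< N (λ k → g (suc k)))
    ≡⟨ +-interchange (f 0) (g 0) _ _ ⟩
  f 0 + ∑< N (λ k → f (suc k)) + (g 0 + ∑< N (λ k → g (suc k))) ∎
  where
  +-interchange : ∀ a b c d → a + b + (c + d) ≡ a + c + (b + d)
  +-interchange = solve-∀

∑<-*ˡ : ∀ N c (f : ℕ → ℕ) → ∑< N (λ k → c * f k) ≡ c * ∑< N f
∑<-*ˡ zero    c f = sym (*-zeroʳ c)
∑<-*ˡ (suc N) c f = trans (cong (c * f 0 +_) (∑<-*ˡ N c (λ k → f (suc k))))
                          (sym (*-distribˡ-+ c (f 0) _))

∑<-drop-last : ∀ N (f : ℕ → ℕ) → f N ≡ 0 → ∑< (suc N) f ≡ ∑< N f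
∑<-drop-last zero    f f0≡0 = cong (_+ 0) f0≡0
∑<-drop-last (suc N) f fN≡0 = cong (f 0 +_) (∑<-drop-last N (λ k → f (suc k)) fN≡0)

sum-map-applyUpTo : ∀ N (f g : ℕ → ℕ) → sum (map f (applyUpTo g N)) ≡ ∑< N (λ k → f (g k))
sum-map-applyUpTo zero    f g = refl
sum-map-applyUpTo (suc N) f g = cong (f (g 0) +_) (sum-map-applyUpTo N f (λ k → g (suc k)))

[n+1]C[k+1]≡nCk+nC[k+1] : ∀ n k → suc n C suc k ≡ n C k + n C suc k
[n+1]C[k+1]≡nCk+nC[k+1] n k = sym (nCk+nC[k+1]≡[n+1]C[k+1] n k)

[1+k]*[1+n]C[1+k]≡[1+n]*nCk : ∀ n k → suc k * (suc n C suc k) ≡ suc n * (n C k)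
[1+k]*[1+n]C[1+k]≡[1+n]*nCk zero    zero    = refl
[1+k]*[1+n]C[1+k]≡[1+n]*nCk zero    (suc k) = *-zeroʳ (2 + k)
[1+k]*[1+n]C[1+k]≡[1+n]*nCk (suc n) zero    =
  trans (+-identityʳ _) (trans (nC1≡n (2 + n)) (sym (*-identityʳ (2 + n))))
[1+k]*[1+n]C[1+k]≡[1+n]*nCk (suc n) (suc k) = begin
  (2 + k) * (suc (suc n) C suc (suc k))
    ≡⟨ cong ((2 + k) *_) ([n+1]C[k+1]≡nCk+nC[k+1] (suc n) (suc k)) ⟩
  (2 + k) * (X + Y)
    ≡⟨ expand k X Y ⟩
  X + (1 + k) * X + (2 + k) * Y
    ≡⟨ cong₂ (λ x y → X + x + y) ([1+k]*[1+n]C[1+k]≡[1+n]*nCk n k)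
                                 ([1+k]*[1+n]C[1+k]≡[1+n]*nCk n (suc k)) ⟩
  X + (1 + n) * (n C k) + (1 + n) * (n C suc k)
    ≡⟨ +-assoc X ((1 + n) * (n C k)) _ ⟩
  X + ((1 + n) * (n C k) + (1 + n) * (n C suc k))
    ≡⟨ cong (X +_) (sym (*-distribˡ-+ (1 + n) (n C k) (n C suc k))) ⟩
  X + (1 + n) * (n C k + n C suc k)
    ≡⟨ cong (λ x → X + (1 + n) * x) (nCk+nC[k+1]≡[n+1]C[k+1] n k) ⟩
  X + (1 + n) * X
    ∎
  where
  X = suc n C suc k
  Y = suc n C suc (suc k)
  expand : ∀ k X Y → (2 + k) * (X + Y) ≡ X + (1 + k) * X + (2 + k) * Y
  expand = solve-∀

[1+k]*[2k]C[1+k]≡k*[2k]Ck : ∀ k → suc k * ((2 * k) C suc k) ≡ k * ((2 * k) C k)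
[1+k]*[2k]C[1+k]≡k*[2k]Ck k = +-cancelˡ-≡ (suc k * a) _ _ (begin
  suc k * a + suc k * b     ≡⟨ sym (*-distribˡ-+ (suc k) a b) ⟩
  suc k * (a + b)           ≡⟨ cong (suc k *_) (nCk+nC[k+1]≡[n+1]C[k+1] (2 * k) k) ⟩
  suc k * (suc (2 * k) C suc k) ≡⟨ [1+k]*[1+n]C[1+k]≡[1+n]*nCk (2 * k) k ⟩
  suc (2 * k) * a           ≡⟨ split k a ⟩
  suc k * a + k * a         ∎)
  where
  a = (2 * k) C k
  b = (2 * k) C suc k
  split : ∀ k a → suc (2 * k) * a ≡ suc k * a + k * a
  split = solve-∀

catalan+[2k]C[1+k]≡[2k]Ck : ∀ k → catalan k + (2 * k) C suc k ≡ (2 * k) C k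
catalan+[2k]C[1+k]≡[2k]Ck k = begin
  catalan k + b ≡⟨ cong (_+ b) catalan≡a∸b ⟩
  a ∸ b + b     ≡⟨ m∸n+n≡m b≤a ⟩
  a             ∎
  where
  a = (2 * k) C k
  b = (2 * k) C suc k
  ballot : suc k * b ≡ k * a
  ballot = [1+k]*[2k]C[1+k]≡k*[2k]Ck k
  b≤a : b ≤ a
  b≤a = *-cancelˡ-≤ (suc k) (subst (_≤ suc k * a) (sym ballot) (m≤n+m (k * a) a))
  [a∸b]*[1+k]≡a : (a ∸ b) * suc k ≡ a
  [a∸b]*[1+k]≡a = begin
    (a ∸ b) * suc k         ≡⟨ *-comm (a ∸ b) (suc k) ⟩
    suc k * (a ∸ b)         ≡⟨ *-distribˡ-∸ (suc k) a b ⟩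
    suc k * a ∸ suc k * b   ≡⟨ cong (suc k * a ∸_) ballot ⟩
    a + k * a ∸ k * a       ≡⟨ m+n∸n≡m a (k * a) ⟩
    a                       ∎
  catalan≡a∸b : catalan k ≡ a ∸ b
  catalan≡a∸b = trans (cong (_/ suc k) (sym [a∸b]*[1+k]≡a)) (m*n/n≡m (a ∸ b) (suc k))

-- T(n,j): choose the j + 2k factors of (1 + x + x⁻¹)^n not contributing 1, then the j + k
-- of them contributing x.
trinomialTerm : ℕ → ℕ → ℕ → ℕ
trinomialTerm n j k = (n C (j + k + k)) * ((j + k + k) C (j + k))

trinomial : ℕ → ℕ → ℕ
trinomial n j = ∑< (suc n) (trinomialTerm n j)

trinomialTerm-vanishes : ∀ {n} j k → n < j + k + k → trinomialTerm n j k ≡ 0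
trinomialTerm-vanishes j k n<j+2k = cong (_* ((j + k + k) C (j + k))) (k>n⇒nCk≡0 n<j+2k)

trinomial-extend : ∀ n j → ∑< (2 + n) (trinomialTerm n j) ≡ trinomial n j
trinomial-extend n j = ∑<-drop-last (suc n) (trinomialTerm n j)
  (trinomialTerm-vanishes j (suc n) (≤-trans (n<1+n n) (m≤n+m (suc n) (j + suc n))))

trinomialTerm⁺ : ℕ → ℕ → ℕ → ℕ
trinomialTerm⁺ n j k = (n C (j + k + k)) * ((j + k + k) C suc (j + k))

trinomialTerm⁺-zero : ∀ n j → trinomialTerm⁺ n j 0 ≡ 0
trinomialTerm⁺-zero n j = trans (cong ((n C (j + 0 + 0)) *_) (k>n⇒nCk≡0 j+0+0<1+j+0))
                                (*-zeroʳ (n C (j + 0 + 0)))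
  where
  j+0+0<1+j+0 : j + 0 + 0 < suc (j + 0)
  j+0+0<1+j+0 = s≤s (≤-reflexive (+-identityʳ (j + 0)))

trinomialTerm⁺-suc : ∀ n j k → trinomialTerm⁺ n j (suc k) ≡ trinomialTerm n (2 + j) k
trinomialTerm⁺-suc n j k = cong₂ (λ N J → (n C N) * (N C J)) top bottom
  where
  bottom : suc (j + suc k) ≡ 2 + j + k
  bottom = cong suc (+-suc j k)
  top : j + suc k + suc k ≡ 2 + j + k + k
  top = trans (+-suc (j + suc k) k) (cong (λ m → suc (m + k)) (+-suc j k))

trinomialTerm-suc-suc : ∀ n j k →
  trinomialTerm (suc n) (suc j) k ≡ trinomialTerm n j k + trinomialTerm n (suc j) k + trinomialTerm⁺ n j k
trinomialTerm-suc-suc n j k = begin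
  (suc n C suc N) * (suc N C suc L)
    ≡⟨ cong (_* (suc N C suc L)) ([n+1]C[k+1]≡nCk+nC[k+1] n N) ⟩
  (n C N + n C suc N) * (suc N C suc L)
    ≡⟨ cong (λ c → (n C N + n C suc N) * c) ([n+1]C[k+1]≡nCk+nC[k+1] N L) ⟩
  (n C N + n C suc N) * (N C L + N C suc L)
    ≡⟨ expand (n C N) (n C suc N) (N C L) (N C suc L) ⟩
  (n C N) * (N C L) + (n C suc N) * (N C L + N C suc L) + (n C N) * (N C suc L)
    ≡⟨ cong (λ c → (n C N) * (N C L) + (n C suc N) * c + (n C N) * (N C suc L))
            (nCk+nC[k+1]≡[n+1]C[k+1] N L) ⟩
  (n C N) * (N C L) + (n C suc N) * (suc N C suc L) + (n C N) * (N C suc L)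
    ∎
  where
  N = j + k + k
  L = j + k
  expand : ∀ a b c d → (a + b) * (c + d) ≡ a * c + b * (c + d) + a * d
  expand = solve-∀

trinomial-suc-suc : ∀ n j →
  trinomial (suc n) (suc j) ≡ trinomial n j + trinomial n (suc j) + trinomial n (2 + j)
trinomial-suc-suc n j = begin
  ∑< (2 + n) (trinomialTerm (suc n) (suc j))
    ≡⟨ ∑<-cong (2 + n) (trinomialTerm-suc-suc n j) ⟩
  ∑< (2 + n) (λ k → trinomialTerm n j k + trinomialTerm n (suc j) k + trinomialTerm⁺ n j k)
    ≡⟨ ∑<-distrib-+ (2 + n) (λ k → trinomialTerm n j k + trinomialTerm n (suc j) k)
                    (trinomialTerm⁺ n j) ⟩
  ∑< (2 + n) (λ k → trinomialTerm n j k + trinomialTerm n (suc j) k) + ∑< (2 + n) (trinomialTerm⁺ n j)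
    ≡⟨ cong (_+ ∑< (2 + n) (trinomialTerm⁺ n j))
            (∑<-distrib-+ (2 + n) (trinomialTerm n j) (trinomialTerm n (suc j))) ⟩
  ∑< (2 + n) (trinomialTerm n j) + ∑< (2 + n) (trinomialTerm n (suc j)) + ∑< (2 + n) (trinomialTerm⁺ n j)
    ≡⟨ cong₂ _+_ (cong₂ _+_ (trinomial-extend n j) (trinomial-extend n (suc j))) shifted ⟩
  trinomial n j + trinomial n (suc j) + trinomial n (2 + j)
    ∎
  where
  shifted : ∑< (2 + n) (trinomialTerm⁺ n j) ≡ trinomial n (2 + j)
  shifted = cong₂ _+_ (trinomialTerm⁺-zero n j) (∑<-cong (suc n) (trinomialTerm⁺-suc n j))

trinomialTerm-suc-zero : ∀ n k →
  trinomialTerm (suc n) 0 (suc k) ≡ trinomialTerm n 0 (suc k) + 2 * trinomialTerm n 1 k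
trinomialTerm-suc-zero n k = begin
  (suc n C suc N) * (suc N C suc k)
    ≡⟨ cong₂ _*_ ([n+1]C[k+1]≡nCk+nC[k+1] n N) ([n+1]C[k+1]≡nCk+nC[k+1] N k) ⟩
  (n C N + n C suc N) * (N C k + N C suc k)
    ≡⟨ *-distribʳ-+ (N C k + N C suc k) (n C N) (n C suc N) ⟩
  (n C N) * (N C k + N C suc k) + (n C suc N) * (N C k + N C suc k)
    ≡⟨ cong₂ _+_ (cong (λ c → (n C N) * (c + N C suc k)) symmetric)
                 (cong ((n C suc N) *_) (nCk+nC[k+1]≡[n+1]C[k+1] N k)) ⟩
  (n C N) * (N C suc k + N C suc k) + (n C suc N) * (suc N C suc k)
    ≡⟨ cong (_+ (n C suc N) * (suc N C suc k)) (double (n C N) (N C suc k)) ⟩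
  2 * ((n C N) * (N C suc k)) + trinomialTerm n 0 (suc k)
    ≡⟨ +-comm (2 * ((n C N) * (N C suc k))) _ ⟩
  trinomialTerm n 0 (suc k) + 2 * ((n C N) * (N C suc k))
    ≡⟨ cong (λ M → trinomialTerm n 0 (suc k) + 2 * ((n C M) * (M C suc k))) (+-suc k k) ⟩
  trinomialTerm n 0 (suc k) + 2 * trinomialTerm n 1 k
    ∎
  where
  N = k + suc k
  symmetric : N C k ≡ N C suc k
  symmetric = trans (nCk≡nC[n∸k] (m≤m+n k (suc k))) (cong (N C_) (m+n∸m≡n k (suc k)))
  double : ∀ a c → a * (c + c) ≡ 2 * (a * c)
  double = solve-∀

trinomial-suc-zero : ∀ n → trinomial (suc n) 0 ≡ trinomial n 0 + 2 * trinomial n 1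
-- The k = 0 terms on both sides are 1, hence the outer suc.
trinomial-suc-zero n = cong suc (begin
  ∑< (suc n) (λ k → trinomialTerm (suc n) 0 (suc k))
    ≡⟨ ∑<-cong (suc n) (trinomialTerm-suc-zero n) ⟩
  ∑< (suc n) (λ k → trinomialTerm n 0 (suc k) + 2 * trinomialTerm n 1 k)
    ≡⟨ ∑<-distrib-+ (suc n) (λ k → trinomialTerm n 0 (suc k)) (λ k → 2 * trinomialTerm n 1 k) ⟩
  ∑< (suc n) (λ k → trinomialTerm n 0 (suc k)) + ∑< (suc n) (λ k → 2 * trinomialTerm n 1 k)
    ≡⟨ cong₂ _+_ (∑<-drop-last n (λ k → trinomialTerm n 0 (suc k)) top-vanishes)
                 (∑<-*ˡ (suc n) 2 (trinomialTerm n 1)) ⟩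
  ∑< n (λ k → trinomialTerm n 0 (suc k)) + 2 * trinomial n 1
    ∎)
  where
  top-vanishes : trinomialTerm n 0 (suc n) ≡ 0
  top-vanishes = trinomialTerm-vanishes 0 (suc n) (≤-trans (n<1+n n) (m≤m+n (suc n) (suc n)))

motzkin+trinomial[n,2]≡trinomial[n,0] : ∀ n → motzkin n + trinomial n 2 ≡ trinomial n 0
motzkin+trinomial[n,2]≡trinomial[n,0] n = begin
  motzkin n + trinomial n 2
    ≡⟨ cong₂ _+_ (sum-map-applyUpTo (suc n) catalanTerm (λ k → k)) trinomial[n,2]≡∑ballotTerm ⟩
  ∑< (suc n) catalanTerm + ∑< (suc n) ballotTerm
    ≡⟨ sym (∑<-distrib-+ (suc n) catalanTerm ballotTerm) ⟩
  ∑< (suc n) (λ k → catalanTerm k + ballotTerm k)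
    ≡⟨ ∑<-cong (suc n) termwise ⟩
  trinomial n 0
    ∎
  where
  2k≡k+k : ∀ k → 2 * k ≡ k + k
  2k≡k+k k = cong (k +_) (+-identityʳ k)
  catalanTerm ballotTerm : ℕ → ℕ
  catalanTerm k = (n C (2 * k)) * catalan k
  ballotTerm k = (n C (2 * k)) * ((2 * k) C suc k)
  -- The last step uses that ballotTerm 0 reduces to 0.
  trinomial[n,2]≡∑ballotTerm : trinomial n 2 ≡ ∑< (suc n) ballotTerm
  trinomial[n,2]≡∑ballotTerm = begin
    trinomial n 2
      ≡⟨ ∑<-drop-last n (trinomialTerm n 2)
           (trinomialTerm-vanishes 2 n (s≤s (≤-trans (m≤m+n n n) (n≤1+n (n + n))))) ⟩
    ∑< n (trinomialTerm n 2)
      ≡⟨ ∑<-cong n (λ k → cong (λ M → (n C M) * (M C (2 + k)))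
                                (sym (trans (*-suc 2 k) (cong (2 +_) (2k≡k+k k))))) ⟩
    ∑< n (λ k → ballotTerm (suc k))
      ∎
  termwise : ∀ k → catalanTerm k + ballotTerm k ≡ trinomialTerm n 0 k
  termwise k = begin
    (n C (2 * k)) * catalan k + (n C (2 * k)) * ((2 * k) C suc k)
      ≡⟨ sym (*-distribˡ-+ (n C (2 * k)) (catalan k) _) ⟩
    (n C (2 * k)) * (catalan k + (2 * k) C suc k)
      ≡⟨ cong ((n C (2 * k)) *_) (catalan+[2k]C[1+k]≡[2k]Ck k) ⟩
    (n C (2 * k)) * ((2 * k) C k)
      ≡⟨ cong (λ M → (n C M) * (M C k)) (2k≡k+k k) ⟩
    trinomialTerm n 0 k
      ∎

ℤ₃ : Set
ℤ₃ = Fin 3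

infixl 6 _⊕_ _⊖_
infixl 7 _⊛_

_⊕_ _⊛_ _⊖_ : ℤ₃ → ℤ₃ → ℤ₃
x ⊕ y = (toℕ x + toℕ y) mod 3
x ⊛ y = (toℕ x * toℕ y) mod 3
x ⊖ y = x ⊕ 2F ⊛ y

decide₁ : {f g : ℤ₃ → ℤ₃} {valid : True (all? λ x → f x ≟ g x)} → ∀ x → f x ≡ g x
decide₁ {valid = valid} = toWitness valid

decide₂ : {f g : ℤ₃ → ℤ₃ → ℤ₃} {valid : True (all? λ x → all? λ y → f x y ≟ g x y)} →
          ∀ x y → f x y ≡ g x y
decide₂ {valid = valid} = toWitness valid

decide₃ : {f g : ℤ₃ → ℤ₃ → ℤ₃ → ℤ₃}
          {valid : True (all? λ x → all? λ y → all? λ z → f x y z ≟ g x y z)} →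
          ∀ x y z → f x y z ≡ g x y z
decide₃ {valid = valid} = toWitness valid

toℕ-mod3 : ∀ m → toℕ (m mod 3) ≡ m % 3
toℕ-mod3 m = toℕ-fromℕ< _

mod3-cong : ∀ m n → m % 3 ≡ n % 3 → m mod 3 ≡ n mod 3
mod3-cong m n eq = fromℕ<-cong (m % 3) (n % 3) eq _ _

+-mod3 : ∀ m n → (m + n) mod 3 ≡ m mod 3 ⊕ n mod 3
+-mod3 m n = mod3-cong (m + n) (toℕ (m mod 3) + toℕ (n mod 3)) (trans (%-distribˡ-+ m n 3)
  (sym (cong₂ (λ a b → (a + b) % 3) (toℕ-mod3 m) (toℕ-mod3 n))))

*-mod3 : ∀ m n → (m * n) mod 3 ≡ (m mod 3) ⊛ (n mod 3)
*-mod3 m n = mod3-cong (m * n) (toℕ (m mod 3) * toℕ (n mod 3)) (trans (%-distribˡ-* m n 3)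
  (sym (cong₂ (λ a b → (a * b) % 3) (toℕ-mod3 m) (toℕ-mod3 n))))

τ : ℕ → ℕ → ℤ₃
τ n j = trinomial n j mod 3

-- T(n+1,j) = T(n,j-1) + T(n,j) + T(n,j+1), with T(n,-1) = T(n,1).
nextRow : (ℕ → ℤ₃) → ℕ → ℤ₃
nextRow r zero    = r 0 ⊕ 2F ⊛ r 1
nextRow r (suc j) = r j ⊕ r (suc j) ⊕ r (2 + j)

τ-suc : ∀ n j → τ (suc n) j ≡ nextRow (τ n) j
τ-suc n zero = begin
  (trinomial (suc n) 0) mod 3             ≡⟨ cong (_mod 3) (trinomial-suc-zero n) ⟩
  (trinomial n 0 + 2 * trinomial n 1) mod 3 ≡⟨ +-mod3 (trinomial n 0) _ ⟩
  τ n 0 ⊕ (2 * trinomial n 1) mod 3       ≡⟨ cong (τ n 0 ⊕_) (*-mod3 2 (trinomial n 1)) ⟩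
  τ n 0 ⊕ 2F ⊛ τ n 1                      ∎
τ-suc n (suc j) = begin
  (trinomial (suc n) (suc j)) mod 3
    ≡⟨ cong (_mod 3) (trinomial-suc-suc n j) ⟩
  (trinomial n j + trinomial n (suc j) + trinomial n (2 + j)) mod 3
    ≡⟨ +-mod3 (trinomial n j + trinomial n (suc j)) _ ⟩
  (trinomial n j + trinomial n (suc j)) mod 3 ⊕ τ n (2 + j)
    ≡⟨ cong (_⊕ τ n (2 + j)) (+-mod3 (trinomial n j) _) ⟩
  τ n j ⊕ τ n (suc j) ⊕ τ n (2 + j)
    ∎

record Interleaves (r f g h : ℕ → ℤ₃) : Set where
  field
    at-3i   : ∀ i → r (3 * i) ≡ f i
    at-3i+1 : ∀ i → r (1 + 3 * i) ≡ g i
    at-3i+2 : ∀ i → r (2 + 3 * i) ≡ h i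

open Interleaves

Interleaves-next : ∀ {r r′ f g h f′ g′ h′} →
  (∀ j → r′ j ≡ nextRow r j) →
  Interleaves r f g h →
  f 0 ⊕ 2F ⊛ g 0 ≡ f′ 0 →
  (∀ i → h i ⊕ f (suc i) ⊕ g (suc i) ≡ f′ (suc i)) →
  (∀ i → f i ⊕ g i ⊕ h i ≡ g′ i) →
  (∀ i → g i ⊕ h i ⊕ f (suc i) ≡ h′ i) →
  Interleaves r′ f′ g′ h′
Interleaves-next {r} {r′} {f} {g} r′≡next row new-at-0 new-at-3i+3 new-at-3i+1 new-at-3i+2 = record
  { at-3i   = λ where
      zero    → trans (r′≡next 0)
                  (trans (cong₂ (λ a b → a ⊕ 2F ⊛ b) (at-3i row 0) (at-3i+1 row 0)) new-at-0)
      (suc i) → trans (cong r′ (*-suc 3 i)) (trans (r′≡next (3 + 3 * i))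
                  (trans (cong₂ _⊕_ (cong₂ _⊕_ (at-3i+2 row i) (r-3i+3 i)) (r-3i+4 i)) (new-at-3i+3 i)))
  ; at-3i+1 = λ i → trans (r′≡next (1 + 3 * i))
      (trans (cong₂ _⊕_ (cong₂ _⊕_ (at-3i row i) (at-3i+1 row i)) (at-3i+2 row i)) (new-at-3i+1 i))
  ; at-3i+2 = λ i → trans (r′≡next (2 + 3 * i))
      (trans (cong₂ _⊕_ (cong₂ _⊕_ (at-3i+1 row i) (at-3i+2 row i)) (r-3i+3 i)) (new-at-3i+2 i))
  }
  where
  r-3i+3 : ∀ i → r (3 + 3 * i) ≡ f (suc i)
  r-3i+3 i = trans (cong r (sym (*-suc 3 i))) (at-3i row (suc i))
  r-3i+4 : ∀ i → r (4 + 3 * i) ≡ g (suc i)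
  r-3i+4 i = trans (cong (λ m → r (1 + m)) (sym (*-suc 3 i))) (at-3i+1 row (suc i))

row-3q   : ∀ q → Interleaves (τ (3 * q)) (τ q) (λ _ → 0F) (λ _ → 0F)
row-3q+1 : ∀ q → Interleaves (τ (1 + 3 * q)) (τ q) (τ q) (λ i → τ q (suc i))
row-3q+2 : ∀ q → Interleaves (τ (2 + 3 * q)) (λ _ → 0F)
                             (λ i → 2F ⊛ τ q i ⊕ τ q (suc i))
                             (λ i → τ q i ⊕ 2F ⊛ τ q (suc i))

row-3q zero = record
  { at-3i   = λ where
      zero    → refl
      (suc i) → cong (τ 0) (*-suc 3 i)
  ; at-3i+1 = λ _ → refl
  ; at-3i+2 = λ _ → refl
  }
row-3q (suc q) =
  subst (λ n → Interleaves (τ n) (τ (suc q)) (λ _ → 0F) (λ _ → 0F)) (sym (*-suc 3 q))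
  (Interleaves-next (τ-suc (2 + 3 * q)) (row-3q+2 q)
    (trans (0⊕2[2a⊕b]≡a⊕2b (τ q 0) (τ q 1)) (sym (τ-suc q 0)))
    (λ i → trans (a⊕2b⊕0⊕[2b⊕c]≡a⊕b⊕c (τ q i) (τ q (suc i)) (τ q (2 + i)))
                 (sym (τ-suc q (suc i))))
    (λ i → 0⊕[2a⊕b]⊕[a⊕2b]≡0 (τ q i) (τ q (suc i)))
    (λ i → [2a⊕b]⊕[a⊕2b]⊕0≡0 (τ q i) (τ q (suc i))))
  where
  0⊕2[2a⊕b]≡a⊕2b : ∀ a b → 0F ⊕ 2F ⊛ (2F ⊛ a ⊕ b) ≡ a ⊕ 2F ⊛ b
  0⊕2[2a⊕b]≡a⊕2b = decide₂
  a⊕2b⊕0⊕[2b⊕c]≡a⊕b⊕c : ∀ a b c → a ⊕ 2F ⊛ b ⊕ 0F ⊕ (2F ⊛ b ⊕ c) ≡ a ⊕ b ⊕ c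
  a⊕2b⊕0⊕[2b⊕c]≡a⊕b⊕c = decide₃
  0⊕[2a⊕b]⊕[a⊕2b]≡0 : ∀ a b → 0F ⊕ (2F ⊛ a ⊕ b) ⊕ (a ⊕ 2F ⊛ b) ≡ 0F
  0⊕[2a⊕b]⊕[a⊕2b]≡0 = decide₂
  [2a⊕b]⊕[a⊕2b]⊕0≡0 : ∀ a b → 2F ⊛ a ⊕ b ⊕ (a ⊕ 2F ⊛ b) ⊕ 0F ≡ 0F
  [2a⊕b]⊕[a⊕2b]⊕0≡0 = decide₂

row-3q+1 q = Interleaves-next (τ-suc (3 * q)) (row-3q q)
  (a⊕2·0≡a (τ q 0))
  (λ i → 0⊕a⊕0≡a (τ q (suc i)))
  (λ i → a⊕0⊕0≡a (τ q i))
  (λ i → 0⊕0⊕a≡a (τ q (suc i)))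
  where
  a⊕2·0≡a : ∀ a → a ⊕ 2F ⊛ 0F ≡ a
  a⊕2·0≡a = decide₁
  0⊕a⊕0≡a : ∀ a → 0F ⊕ a ⊕ 0F ≡ a
  0⊕a⊕0≡a = decide₁
  a⊕0⊕0≡a : ∀ a → a ⊕ 0F ⊕ 0F ≡ a
  a⊕0⊕0≡a = decide₁
  0⊕0⊕a≡a : ∀ a → 0F ⊕ 0F ⊕ a ≡ a
  0⊕0⊕a≡a = decide₁

row-3q+2 q = Interleaves-next (τ-suc (1 + 3 * q)) (row-3q+1 q)
  (a⊕2a≡0 (τ q 0))
  (λ i → a⊕a⊕a≡0 (τ q (suc i)))
  (λ i → a⊕a⊕b≡2a⊕b (τ q i) (τ q (suc i)))
  (λ i → a⊕b⊕b≡a⊕2b (τ q i) (τ q (suc i)))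
  where
  a⊕2a≡0 : ∀ a → a ⊕ 2F ⊛ a ≡ 0F
  a⊕2a≡0 = decide₁
  a⊕a⊕a≡0 : ∀ a → a ⊕ a ⊕ a ≡ 0F
  a⊕a⊕a≡0 = decide₁
  a⊕a⊕b≡2a⊕b : ∀ a b → a ⊕ a ⊕ b ≡ 2F ⊛ a ⊕ b
  a⊕a⊕b≡2a⊕b = decide₂
  a⊕b⊕b≡a⊕2b : ∀ a b → a ⊕ b ⊕ b ≡ a ⊕ 2F ⊛ b
  a⊕b⊕b≡a⊕2b = decide₂

τ₀ : ℕ → ℤ₃
τ₀ m = τ m 0

T01⇒τ₀≡1 : ∀ {m} → T01 m → τ₀ m ≡ 1F
T01⇒τ₀≡1 t-zero         = refl
T01⇒τ₀≡1 (t-dig0 {m} t) = trans (at-3i (row-3q m) 0) (T01⇒τ₀≡1 t)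
T01⇒τ₀≡1 (t-dig1 {m} t) =
  trans (cong τ₀ (+-comm (3 * m) 1)) (trans (at-3i (row-3q+1 m) 0) (T01⇒τ₀≡1 t))

data Residue3 : ℕ → Set where
  3q   : ∀ q → Residue3 (3 * q)
  3q+1 : ∀ q → Residue3 (1 + 3 * q)
  3q+2 : ∀ q → Residue3 (2 + 3 * q)

residue3 : ∀ n → Residue3 n
residue3 zero = 3q 0
residue3 (suc n) with residue3 n
... | 3q q   = 3q+1 q
... | 3q+1 q = 3q+2 q
... | 3q+2 q = subst Residue3 (*-suc 3 q) (3q (suc q))

τ₀≡0⊎T01 : ∀ m → τ₀ m ≡ 0F ⊎ T01 m
τ₀≡0⊎T01 = <-rec _ byResidue
  where
  byResidue : ∀ m → (∀ {k} → k < m → τ₀ k ≡ 0F ⊎ T01 k) → τ₀ m ≡ 0F ⊎ T01 m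
  byResidue m rec with residue3 m
  ... | 3q zero    = inj₂ t-zero
  ... | 3q (suc q) = Sum.map (trans (at-3i (row-3q (suc q)) 0)) t-dig0
                             (rec (m<m+n (suc q) (s≤s z≤n)))
  ... | 3q+1 q     = Sum.map (trans (at-3i (row-3q+1 q) 0))
                             (λ t → subst T01 (+-comm (3 * q) 1) (t-dig1 t))
                             (rec (s≤s (m≤m+n q (2 * q))))
  ... | 3q+2 q     = inj₁ (at-3i (row-3q+2 q) 0)

motzkin-mod3 : ∀ n → motzkin n mod 3 ≡ τ n 0 ⊖ τ n 2
motzkin-mod3 n = begin
  motzkin n mod 3
    ≡⟨ sym (a⊕b⊖b≡a (motzkin n mod 3) (τ n 2)) ⟩
  motzkin n mod 3 ⊕ τ n 2 ⊖ τ n 2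
    ≡⟨ cong (_⊖ τ n 2) (sym (+-mod3 (motzkin n) (trinomial n 2))) ⟩
  (motzkin n + trinomial n 2) mod 3 ⊖ τ n 2
    ≡⟨ cong (λ m → m mod 3 ⊖ τ n 2) (motzkin+trinomial[n,2]≡trinomial[n,0] n) ⟩
  τ n 0 ⊖ τ n 2
    ∎
  where
  a⊕b⊖b≡a : ∀ a b → a ⊕ b ⊖ b ≡ a
  a⊕b⊖b≡a = decide₂

motzkin[3q]-mod3 : ∀ q → motzkin (3 * q) mod 3 ≡ τ₀ q
motzkin[3q]-mod3 q = trans (motzkin-mod3 (3 * q))
  (trans (cong₂ _⊖_ (at-3i (row-3q q) 0) (at-3i+2 (row-3q q) 0)) (a⊖0≡a (τ₀ q)))
  where
  a⊖0≡a : ∀ a → a ⊖ 0F ≡ a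
  a⊖0≡a = decide₁

motzkin[3q+1]-mod3 : ∀ q → motzkin (1 + 3 * q) mod 3 ≡ τ₀ (suc q)
motzkin[3q+1]-mod3 q = trans (motzkin-mod3 (1 + 3 * q))
  (trans (cong₂ _⊖_ (at-3i (row-3q+1 q) 0) (at-3i+2 (row-3q+1 q) 0)) (sym (τ-suc q 0)))

motzkin[3q+2]-mod3 : ∀ q → motzkin (2 + 3 * q) mod 3 ≡ 2F ⊛ τ₀ (suc q)
motzkin[3q+2]-mod3 q = trans (motzkin-mod3 (2 + 3 * q))
  (trans (cong₂ _⊖_ (at-3i (row-3q+2 q) 0) (trans (at-3i+2 (row-3q+2 q) 0) (sym (τ-suc q 0))))
         (0⊖a≡2a (τ₀ (suc q))))
  where
  0⊖a≡2a : ∀ a → 0F ⊖ a ≡ 2F ⊛ a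
  0⊖a≡2a = decide₁

1+n≡3m⇒n≡2+3[m-1] : ∀ {n m} → suc n ≡ 3 * m → ∃ λ q → m ≡ suc q × n ≡ 2 + 3 * q
1+n≡3m⇒n≡2+3[m-1] {m = suc q} eq = q , refl , suc-injective (trans eq (*-suc 3 q))

motzkin%3≡toℕ : ∀ n {c} → motzkin n mod 3 ≡ c → motzkin n % 3 ≡ toℕ c
motzkin%3≡toℕ n eq = trans (sym (toℕ-mod3 (motzkin n))) (cong toℕ eq)

motzkin%3-3T01-1 : ∀ {n} → (∃ λ m → T01 m × n + 1 ≡ 3 * m) → motzkin n % 3 ≡ 2
motzkin%3-3T01-1 {n} (m , t , eq) with 1+n≡3m⇒n≡2+3[m-1] {n} {m} (trans (+-comm 1 n) eq)
... | q , refl , refl =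
  motzkin%3≡toℕ (2 + 3 * q) (trans (motzkin[3q+2]-mod3 q) (cong (2F ⊛_) (T01⇒τ₀≡1 t)))

motzkin%3-3T01 : ∀ {n} → (∃ λ m → T01 m × n ≡ 3 * m) → motzkin n % 3 ≡ 1
motzkin%3-3T01 (m , t , refl) = motzkin%3≡toℕ (3 * m) (trans (motzkin[3q]-mod3 m) (T01⇒τ₀≡1 t))

motzkin%3-3T01-2 : ∀ {n} → (∃ λ m → T01 m × n + 2 ≡ 3 * m) → motzkin n % 3 ≡ 1
motzkin%3-3T01-2 {n} (m , t , eq) with 1+n≡3m⇒n≡2+3[m-1] {suc n} {m} (trans (+-comm 2 n) eq)
... | q , refl , 1+n≡2+3q with suc-injective 1+n≡2+3q
...   | refl = motzkin%3≡toℕ (1 + 3 * q) (trans (motzkin[3q+1]-mod3 q) (T01⇒τ₀≡1 t))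

motzkin%3-otherwise : ∀ n →
  ¬ (∃ λ m → T01 m × n + 1 ≡ 3 * m) →
  ¬ (∃ λ m → T01 m × n ≡ 3 * m) →
  ¬ (∃ λ m → T01 m × n + 2 ≡ 3 * m) →
  motzkin n % 3 ≡ 0
motzkin%3-otherwise n ¬3T01-1 ¬3T01 ¬3T01-2 with residue3 n
... | 3q q = [ (λ τ₀≡0 → motzkin%3≡toℕ (3 * q) (trans (motzkin[3q]-mod3 q) τ₀≡0))
             , (λ t → ⊥-elim (¬3T01 (q , t , refl))) ]′ (τ₀≡0⊎T01 q)
... | 3q+1 q = [ (λ τ₀≡0 → motzkin%3≡toℕ (1 + 3 * q) (trans (motzkin[3q+1]-mod3 q) τ₀≡0))
               , (λ t → ⊥-elim (¬3T01-2 (suc q , t , 1+3q+2≡3[1+q] q))) ]′ (τ₀≡0⊎T01 (suc q))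
  where
  1+3q+2≡3[1+q] : ∀ q → 1 + 3 * q + 2 ≡ 3 * suc q
  1+3q+2≡3[1+q] = solve-∀
... | 3q+2 q = [ (λ τ₀≡0 → motzkin%3≡toℕ (2 + 3 * q)
                             (trans (motzkin[3q+2]-mod3 q) (cong (2F ⊛_) τ₀≡0)))
               , (λ t → ⊥-elim (¬3T01-1 (suc q , t , 2+3q+1≡3[1+q] q))) ]′ (τ₀≡0⊎T01 (suc q))
  where
  2+3q+1≡3[1+q] : ∀ q → 2 + 3 * q + 1 ≡ 3 * suc q
  2+3q+1≡3[1+q] = solve-∀

corollary4p8 : (n : ℕ) →
    ((∃ λ m → T01 m × n + 1 ≡ 3 * m) → motzkin n % 3 ≡ 2)
    × (((∃ λ m → T01 m × n ≡ 3 * m) ⊎ (∃ λ m → T01 m × n + 2 ≡ 3 * m)) → motzkin n % 3 ≡ 1)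
    × (¬ (∃ λ m → T01 m × n + 1 ≡ 3 * m)
       → ¬ (∃ λ m → T01 m × n ≡ 3 * m)
       → ¬ (∃ λ m → T01 m × n + 2 ≡ 3 * m)
       → motzkin n % 3 ≡ 0)
corollary4p8 n = motzkin%3-3T01-1 , [ motzkin%3-3T01 , motzkin%3-3T01-2 ]′ , motzkin%3-otherwise n
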